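{- Let $r\ge 1$ be an integer and let $H=H(A\cup B,A\rightarrow B)$ be an $h$-vertex bipartite digraph such that $|N_B^+(a)|\leq r$ for each $a\in A$. Then there exists a constant $c=c(H)$ such that for every $n$, $$\mathrm{ex}_{\mathrm{ori}}(n,H)\le c\cdot n^{2-\frac{1}{r}}.$$
   Context: An oriented graph is a directed graph with no loops, no multiple arcs and no pair of opposite arcs $\overrightarrow{uv},\overrightarrow{vu}$. For an oriented graph $F$, $\mathrm{ex}_{\mathrm{ori}}(n,F)$ denotes the largest number of arcs in an $n$-vertex oriented graph that does not contain $F$ as a (not necessarily induced) subgraph. The notation $H=H(A\cup B,A\rightarrow B)$ means that $H$ is a bipartite digraph with vertex bipartition $A\cup B$ in which every arc goes from a vertex of $A$ to a vertex of $B$; $N_B^+(a)$ denotes the set of out-neighbours of $a$ in $B$. -}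

module Defs where

open import Data.Nat using (ℕ; zero; suc; _+_; _*_; _∸_; _^_; _≤_)
open import Data.Bool using (Bool; true; false; if_then_else_)
open import Data.Fin using (Fin)
open import Data.Product using (Σ; _×_; ∃-syntax)
open import Data.Empty using (⊥)
open import Relation.Nullary using (¬_)
open import Relation.Binary.PropositionalEquality using (_≡_)
open import Function.Definitions using (Injective)

ΣFin : (n : ℕ) → (Fin n → ℕ) → ℕ
ΣFin zero    f = 0
ΣFin (suc n) f = f Fin.zero + ΣFin n (λ i → f (Fin.suc i))

Digraph : ℕ → Set
Digraph n = Fin n → Fin n → Bool

-- oriented: no loops, no pair of opposite arcs (multiple arcs impossible by representation)
Oriented : {n : ℕ} → Digraph n → Set
Oriented {n} G = (∀ (u : Fin n) → G u u ≡ false)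
               × (∀ (u v : Fin n) → G u v ≡ true → G v u ≡ false)

arcs : {n : ℕ} → Digraph n → ℕ
arcs {n} G = ΣFin n (λ u → ΣFin n (λ v → if G u v then 1 else 0))

-- bipartite digraph H(A ∪ B, A → B) with A = Fin a, B = Fin b:
-- H x y = true means arc from x ∈ A to y ∈ B
BipDigraph : ℕ → ℕ → Set
BipDigraph a b = Fin a → Fin b → Bool

outdegB : {a b : ℕ} → BipDigraph a b → Fin a → ℕ
outdegB {a} {b} H x = ΣFin b (λ y → if H x y then 1 else 0)

Contains : {n a b : ℕ} → Digraph n → BipDigraph a b → Set
Contains {n} {a} {b} G H =
  Σ (Fin a → Fin n) λ f → Σ (Fin b → Fin n) λ g →
    Injective _≡_ _≡_ f × Injective _≡_ _≡_ g
    × (∀ (x : Fin a) (y : Fin b) → ¬ (f x ≡ g y))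
    × (∀ (x : Fin a) (y : Fin b) → H x y ≡ true → G (f x) (g y) ≡ true)

-- Dependent random choice. Let e be the number of arcs of G. Summed over all r-tuples T,
-- the common out-neighbourhoods N⁺(T) have total size Σ_v d⁻(v)^r ≥ e^r / n^(r-1) (power mean).
-- Call an r-tuple S bad if fewer than h = |A| + |B| + 1 vertices are joined to every entry of S.
-- A pair (T, S) with S inside N⁺(T) means T lies inside N⁻(S), so when S is bad there are fewer
-- than h^r such T; hence there are at most n^r h^r such pairs in all. If e^r > (2h)^r n^(2r-1),
-- some T thus has |N⁺(T)| > h + #(bad tuples inside N⁺(T)), and deleting one entry of each bad
-- tuple leaves a set Y of at least h vertices all of whose r-tuples are good. Map B injectively
-- into Y; the image of N_B^+(x), padded to an r-tuple of Y, has at least h common in-neighbours,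
-- enough to place every x ∈ A greedily on distinct vertices outside the image of B.

module Submission where

open import Defs
open import Data.Nat using (ℕ; zero; suc; _+_; _*_; _∸_; _^_; _≤_; _<_; z≤n; s≤s; _<?_; _≤?_; _<ᵇ_; NonZero)
open import Data.Nat.Properties hiding (_≟_)
open import Data.Nat.Induction using (<-rec)
open import Data.Nat.Tactic.RingSolver using (solve-∀)
open import Data.Bool using (Bool; true; false; if_then_else_; _∧_; _∨_; not; T)
open import Data.Bool.Properties
  using (∧-conicalˡ; ∧-conicalʳ; ∨-conicalˡ; ∨-conicalʳ; ∧-zeroʳ; ∧-identityʳ; ∨-identityʳ; ∨-zeroʳ)
open import Data.Unit using (tt)
open import Data.Fin using (Fin; zero; suc; punchIn; _≟_)
open import Data.Fin.Properties using (punchInᵢ≢i)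
open import Data.Vec using (Vec; []; _∷_; replicate)
open import Data.Vec.Functional using (removeAt)
open import Data.Product using (_×_; _,_; ∃-syntax; proj₁; proj₂)
open import Data.Sum using (inj₁; inj₂)
open import Function.Definitions using (Injective)
open import Relation.Nullary using (¬_; yes; no; does; contradiction)
open import Relation.Nullary.Decidable using (dec-true; dec-false)
open import Relation.Binary.PropositionalEquality
open import Algebra.Properties.Semiring.Sum +-*-semiring
  using (sum; sum-syntax; sum-cong-≗; sum-remove; ∑-distrib-+; ∑-comm; *-distribˡ-sum; *-distribʳ-sum)

ΣFin≡sum : ∀ n (f : Fin n → ℕ) → ΣFin n f ≡ sum f
ΣFin≡sum zero    f = refl
ΣFin≡sum (suc n) f = cong (f zero +_) (ΣFin≡sum n (λ i → f (suc i)))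

∑-const : ∀ n c → ∑[ i < n ] c ≡ n * c
∑-const zero    c = refl
∑-const (suc n) c = cong (c +_) (∑-const n c)

sum-mono-≤ : ∀ {n} {f g : Fin n → ℕ} → (∀ i → f i ≤ g i) → sum f ≤ sum g
sum-mono-≤ {zero}  f≤g = z≤n
sum-mono-≤ {suc n} f≤g = +-mono-≤ (f≤g zero) (sum-mono-≤ (λ i → f≤g (suc i)))

sum-mono-< : ∀ {n} {f g : Fin n → ℕ} → (∀ i → f i ≤ g i) → ∀ i → f i < g i → sum f < sum g
sum-mono-< f≤g zero    f<g = +-mono-<-≤ f<g (sum-mono-≤ (λ i → f≤g (suc i)))
sum-mono-< f≤g (suc i) f<g = +-mono-≤-< (f≤g zero) (sum-mono-< (λ i → f≤g (suc i)) i f<g)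

f≤sum : ∀ {n} (f : Fin n → ℕ) i → f i ≤ sum f
f≤sum f zero    = m≤m+n _ _
f≤sum f (suc i) = ≤-trans (f≤sum (λ j → f (suc j)) i) (m≤n+m _ _)

sum<sum⇒∃< : ∀ {n} (f g : Fin n → ℕ) → sum f < sum g → ∃[ i ] f i < g i
sum<sum⇒∃< {zero}  f g ()
sum<sum⇒∃< {suc n} f g ∑f<∑g with f zero <? g zero
... | yes f₀<g₀ = zero , f₀<g₀
... | no  f₀≮g₀ with sum<sum⇒∃< (λ i → f (suc i)) (λ i → g (suc i))
                       (+-cancelˡ-< (g zero) _ _ (≤-<-trans (+-monoˡ-≤ _ (≮⇒≥ f₀≮g₀)) ∑f<∑g))
...   | i , fᵢ<gᵢ = suc i , fᵢ<gᵢ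

sum-update : ∀ {n} (f g : Fin n → ℕ) i → (∀ j → j ≢ i → f j ≡ g j) → sum f + g i ≡ sum g + f i
sum-update {suc n} f g i f≗g = begin
  sum f + g i                         ≡⟨ cong (_+ g i) (sum-remove {i = i} f) ⟩
  f i + sum (removeAt f i) + g i      ≡⟨ cong (λ s → f i + s + g i) agree ⟩
  f i + sum (removeAt g i) + g i      ≡⟨ swap (f i) (sum (removeAt g i)) (g i) ⟩
  g i + sum (removeAt g i) + f i      ≡⟨ cong (_+ f i) (sum-remove {i = i} g) ⟨
  sum g + f i                         ∎
  where
  open ≡-Reasoning
  agree : sum (removeAt f i) ≡ sum (removeAt g i)
  agree = sum-cong-≗ (λ j → f≗g (punchIn i j) (punchInᵢ≢i i j))
  swap : ∀ x y z → x + y + z ≡ z + y + x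
  swap = solve-∀

sum-*-sum : ∀ {n} (e d : Fin n → ℕ) → sum e * sum d ≡ ∑[ i < n ] ∑[ j < n ] (e i * d j)
sum-*-sum e d = trans (*-distribʳ-sum (sum d) e) (sum-cong-≗ (λ i → *-distribˡ-sum (e i) d))

rearrangement : ∀ {a b c d} → a ≤ b → c ≤ d → a * d + b * c ≤ a * c + b * d
rearrangement {a} {c = c} a≤b c≤d with m≤n⇒∃[o]m+o≡n a≤b | m≤n⇒∃[o]m+o≡n c≤d
... | p , refl | q , refl =
  ≤-trans (m≤m+n (a * (c + q) + (a + p) * c) (p * q)) (≤-reflexive (expand a p c q))
  where
  expand : ∀ a p c q → a * (c + q) + (a + p) * c + p * q ≡ a * c + (a + p) * (c + q)
  expand = solve-∀

pow-rearrangement : ∀ k x y → x ^ k * y + y ^ k * x ≤ x ^ k * x + y ^ k * y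
pow-rearrangement k x y with ≤-total x y
... | inj₁ x≤y = rearrangement (^-monoˡ-≤ k x≤y) x≤y
... | inj₂ y≤x = subst₂ _≤_ (+-comm (y ^ k * x) _) (+-comm (y ^ k * y) _) (rearrangement (^-monoˡ-≤ k y≤x) y≤x)

∑∑-distrib-+ : ∀ {m n} (f g : Fin m → Fin n → ℕ) →
  ∑[ i < m ] ∑[ j < n ] (f i j + g i j) ≡ ∑[ i < m ] ∑[ j < n ] f i j + ∑[ i < m ] ∑[ j < n ] g i j
∑∑-distrib-+ f g =
  trans (sum-cong-≗ (λ i → ∑-distrib-+ (f i) (g i))) (∑-distrib-+ (λ i → sum (f i)) (λ i → sum (g i)))

-- Symmetrising the double sum ∑ᵢ∑ⱼ dᵢᵏ dⱼ reduces the claim to the rearrangement inequality.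
chebyshev : ∀ n k (d : Fin n → ℕ) →
  (∑[ i < n ] (d i ^ k)) * sum d ≤ n * ∑[ i < n ] (d i ^ k * d i)
chebyshev n k d = m+m≤n+n⇒m≤n (begin
  sum e * sum d + sum e * sum d
    ≡⟨ cong₂ _+_ (sum-*-sum e d) (trans (sum-*-sum e d) (∑-comm (λ i j → e i * d j))) ⟩
  ∑[ i < n ] ∑[ j < n ] (e i * d j) + ∑[ i < n ] ∑[ j < n ] (e j * d i)
    ≡⟨ ∑∑-distrib-+ (λ i j → e i * d j) (λ i j → e j * d i) ⟨
  ∑[ i < n ] ∑[ j < n ] (e i * d j + e j * d i)
    ≤⟨ sum-mono-≤ (λ i → sum-mono-≤ (λ j → pow-rearrangement k (d i) (d j))) ⟩
  ∑[ i < n ] ∑[ j < n ] (e i * d i + e j * d j)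
    ≡⟨ ∑∑-distrib-+ (λ i j → e i * d i) (λ i j → e j * d j) ⟩
  ∑[ i < n ] ∑[ j < n ] (e i * d i) + ∑[ i < n ] S
    ≡⟨ cong₂ _+_ (trans (sum-cong-≗ (λ i → ∑-const n (ed i))) (sym (*-distribˡ-sum n ed)))
                 (∑-const n S) ⟩
  n * S + n * S ∎)
  where
  open ≤-Reasoning
  e ed : Fin n → ℕ
  e i = d i ^ k
  ed i = e i * d i
  S : ℕ
  S = sum ed
  m+m≤n+n⇒m≤n : ∀ {x y} → x + x ≤ y + y → x ≤ y
  m+m≤n+n⇒m≤n p = ≮⇒≥ (λ y<x → <⇒≱ (+-mono-< y<x y<x) p)

power-mean : ∀ n r (d : Fin n → ℕ) → sum d ^ suc r ≤ n ^ r * ∑[ i < n ] (d i ^ suc r)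
power-mean n zero d = ≤-reflexive (begin
  sum d * 1                      ≡⟨ *-identityʳ _ ⟩
  sum d                          ≡⟨ sum-cong-≗ (λ i → *-identityʳ (d i)) ⟨
  ∑[ i < n ] (d i ^ 1)           ≡⟨ *-identityˡ _ ⟨
  1 * ∑[ i < n ] (d i ^ 1)       ∎)
  where open ≡-Reasoning
power-mean n (suc r) d = begin
  D * D ^ suc r                               ≤⟨ *-monoʳ-≤ D (power-mean n r d) ⟩
  D * (n ^ r * P)                             ≡⟨ reorder₁ D (n ^ r) P ⟩
  n ^ r * (P * D)                             ≤⟨ *-monoʳ-≤ (n ^ r) (chebyshev n (suc r) d) ⟩
  n ^ r * (n * ∑[ i < n ] (d i ^ suc r * d i))  ≡⟨ reorder₂ (n ^ r) n _ ⟩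
  n * n ^ r * ∑[ i < n ] (d i ^ suc r * d i)    ≡⟨ cong (n * n ^ r *_) (sum-cong-≗ (λ i → *-comm (d i ^ suc r) _)) ⟩
  n * n ^ r * ∑[ i < n ] (d i ^ suc (suc r))    ∎
  where
  open ≤-Reasoning
  D P : ℕ
  D = sum d
  P = ∑[ i < n ] (d i ^ suc r)
  reorder₁ : ∀ x y z → x * (y * z) ≡ y * (z * x)
  reorder₁ = solve-∀
  reorder₂ : ∀ x y z → x * (y * z) ≡ y * x * z
  reorder₂ = solve-∀

ind : Bool → ℕ
ind b = if b then 1 else 0

ind-∧ : ∀ a b → ind (a ∧ b) ≡ ind a * ind b
ind-∧ true  b = sym (+-identityʳ (ind b))
ind-∧ false b = refl

ind-mono : ∀ {a b} → (a ≡ true → b ≡ true) → ind a ≤ ind b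
ind-mono {true}  a⇒b rewrite a⇒b refl = ≤-refl
ind-mono {false} a⇒b = z≤n

ind≤1 : ∀ b → ind b ≤ 1
ind≤1 true  = ≤-refl
ind≤1 false = z≤n

ind<ind : ∀ {a b} → ind a < ind b → a ≡ false × b ≡ true
ind<ind {false} {true} _ = refl , refl
ind<ind {true}  {true} (s≤s ())

count : ∀ {n} → (Fin n → Bool) → ℕ
count {n} X = ∑[ v < n ] ind (X v)

_∖⁅_⁆ : ∀ {n} → (Fin n → Bool) → Fin n → Fin n → Bool
(X ∖⁅ v ⁆) w = X w ∧ not (does (w ≟ v))

_∪⁅_⁆ : ∀ {n} → (Fin n → Bool) → Fin n → Fin n → Bool
(X ∪⁅ v ⁆) w = X w ∨ does (w ≟ v)

count-∅ : ∀ n → count {n} (λ _ → false) ≡ 0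
count-∅ n = trans (∑-const n 0) (*-zeroʳ n)

count<count⇒∃ : ∀ {n} (X Y : Fin n → Bool) → count X < count Y → ∃[ v ] X v ≡ false × Y v ≡ true
count<count⇒∃ X Y lt with sum<sum⇒∃< (λ v → ind (X v)) (λ v → ind (Y v)) lt
... | v , lt′ = v , ind<ind lt′

count-∖ : ∀ {n} (X : Fin n → Bool) v → X v ≡ true → count (X ∖⁅ v ⁆) + 1 ≡ count X
count-∖ X v v∈X = begin
  count (X ∖⁅ v ⁆) + 1          ≡⟨ cong (λ b → count (X ∖⁅ v ⁆) + ind b) v∈X ⟨
  count (X ∖⁅ v ⁆) + ind (X v)  ≡⟨ sum-update _ _ v (λ w w≢v → cong ind (outside w w≢v)) ⟩
  count X + ind ((X ∖⁅ v ⁆) v)  ≡⟨ cong (λ b → count X + ind (X v ∧ not b)) (dec-true (v ≟ v) refl) ⟩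
  count X + ind (X v ∧ false)   ≡⟨ cong (λ b → count X + ind b) (∧-zeroʳ (X v)) ⟩
  count X + 0                   ≡⟨ +-identityʳ _ ⟩
  count X                       ∎
  where
  open ≡-Reasoning
  outside : ∀ w → w ≢ v → (X ∖⁅ v ⁆) w ≡ X w
  outside w w≢v = trans (cong (λ b → X w ∧ not b) (dec-false (w ≟ v) w≢v)) (∧-identityʳ (X w))

count-∪ : ∀ {n} (X : Fin n → Bool) v → count (X ∪⁅ v ⁆) ≤ count X + 1
count-∪ X v = begin
  count (X ∪⁅ v ⁆)                  ≤⟨ m≤m+n _ (ind (X v)) ⟩
  count (X ∪⁅ v ⁆) + ind (X v)      ≡⟨ sum-update _ _ v (λ w w≢v → cong ind (outside w w≢v)) ⟩
  count X + ind ((X ∪⁅ v ⁆) v)      ≤⟨ +-monoʳ-≤ (count X) (ind≤1 _) ⟩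
  count X + 1                       ∎
  where
  open ≤-Reasoning
  outside : ∀ w → w ≢ v → (X ∪⁅ v ⁆) w ≡ X w
  outside w w≢v = trans (cong (X w ∨_) (dec-false (w ≟ v) w≢v)) (∨-identityʳ (X w))

∈-∪⁅⁆ : ∀ {n} (X : Fin n → Bool) v → (X ∪⁅ v ⁆) v ≡ true
∈-∪⁅⁆ X v = trans (cong (X v ∨_) (dec-true (v ≟ v) refl)) (∨-zeroʳ (X v))

∉-∖⁅⁆ : ∀ {n} (X : Fin n → Bool) v → (X ∖⁅ v ⁆) v ≡ false
∉-∖⁅⁆ X v = trans (cong (λ b → X v ∧ not b) (dec-true (v ≟ v) refl)) (∧-zeroʳ (X v))

∉-∪⁅⁆⁻¹ : ∀ {n} {X : Fin n → Bool} {v w} → (X ∪⁅ v ⁆) w ≡ false → X w ≡ false × w ≢ v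
∉-∪⁅⁆⁻¹ {X = X} {v} {w} w∉ = ∨-conicalˡ _ _ w∉ , w≢v
  where
  w≢v : w ≢ v
  w≢v w≡v with () ← trans (sym (dec-true (w ≟ v) w≡v)) (∨-conicalʳ (X w) _ w∉)

all : ∀ {A : Set} {r} → (A → Bool) → Vec A r → Bool
all P []      = true
all P (v ∷ T) = P v ∧ all P T

all-mono : ∀ {A : Set} {r} {P Q : A → Bool} → (∀ w → P w ≡ true → Q w ≡ true) →
           (T : Vec A r) → all P T ≡ true → all Q T ≡ true
all-mono P⊆Q []      _  = refl
all-mono P⊆Q (v ∷ T) PT rewrite P⊆Q v (∧-conicalˡ _ _ PT) = all-mono P⊆Q T (∧-conicalʳ _ _ PT)

all-replicate : ∀ {A : Set} r {Q : A → Bool} {y} → Q y ≡ true → all Q (replicate r y) ≡ true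
all-replicate zero    Qy = refl
all-replicate (suc r) Qy rewrite Qy = all-replicate r Qy

all-∧ : ∀ {A : Set} {r} (P Q : A → Bool) (S : Vec A r) → all (λ s → P s ∧ Q s) S ≡ all P S ∧ all Q S
all-∧ P Q []      = refl
all-∧ P Q (v ∷ S) with P v | Q v
... | true  | true  = all-∧ P Q S
... | true  | false = sym (∧-zeroʳ (all P S))
... | false | _     = refl

all-true : ∀ {A : Set} {r} (S : Vec A r) → all (λ _ → true) S ≡ true
all-true []      = refl
all-true (v ∷ S) = all-true S

all-comm : ∀ {A B : Set} {r s} (R : A → B → Bool) (T : Vec A r) (S : Vec B s) →
           all (λ y → all (λ x → R x y) T) S ≡ all (λ x → all (R x) S) T
all-comm R []      S = all-true S
all-comm R (t ∷ T) S = trans (all-∧ (R t) (λ y → all (λ x → R x y) T) S) (cong (all (R t) S ∧_) (all-comm R T S))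

∑ᵗ : ∀ n r → (Vec (Fin n) r → ℕ) → ℕ
∑ᵗ n zero    F = F []
∑ᵗ n (suc r) F = ∑[ v < n ] ∑ᵗ n r (λ T → F (v ∷ T))

module _ {n : ℕ} where

  ∑ᵗ-cong : ∀ r {F G : Vec (Fin n) r → ℕ} → (∀ T → F T ≡ G T) → ∑ᵗ n r F ≡ ∑ᵗ n r G
  ∑ᵗ-cong zero    F≗G = F≗G []
  ∑ᵗ-cong (suc r) F≗G = sum-cong-≗ (λ v → ∑ᵗ-cong r (λ T → F≗G (v ∷ T)))

  ∑ᵗ-mono-≤ : ∀ r {F G : Vec (Fin n) r → ℕ} → (∀ T → F T ≤ G T) → ∑ᵗ n r F ≤ ∑ᵗ n r G
  ∑ᵗ-mono-≤ zero    F≤G = F≤G []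
  ∑ᵗ-mono-≤ (suc r) F≤G = sum-mono-≤ (λ v → ∑ᵗ-mono-≤ r (λ T → F≤G (v ∷ T)))

  f≤∑ᵗ : ∀ r (F : Vec (Fin n) r → ℕ) T → F T ≤ ∑ᵗ n r F
  f≤∑ᵗ zero    F []      = ≤-refl
  f≤∑ᵗ (suc r) F (v ∷ T) = ≤-trans (f≤∑ᵗ r _ T) (f≤sum (λ w → ∑ᵗ n r (λ T → F (w ∷ T))) v)

  ∑ᵗ-mono-< : ∀ r {F G : Vec (Fin n) r → ℕ} → (∀ T → F T ≤ G T) →
              ∀ T → F T < G T → ∑ᵗ n r F < ∑ᵗ n r G
  ∑ᵗ-mono-< zero    F≤G [] F<G = F<G
  ∑ᵗ-mono-< (suc r) F≤G (v ∷ T) F<G =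
    sum-mono-< (λ w → ∑ᵗ-mono-≤ r (λ T → F≤G (w ∷ T))) v (∑ᵗ-mono-< r (λ T → F≤G (v ∷ T)) T F<G)

  ∑ᵗ<∑ᵗ⇒∃< : ∀ r (F G : Vec (Fin n) r → ℕ) → ∑ᵗ n r F < ∑ᵗ n r G → ∃[ T ] F T < G T
  ∑ᵗ<∑ᵗ⇒∃< zero    F G lt = [] , lt
  ∑ᵗ<∑ᵗ⇒∃< (suc r) F G lt with sum<sum⇒∃< _ _ lt
  ... | v , lt′ with ∑ᵗ<∑ᵗ⇒∃< r (λ T → F (v ∷ T)) (λ T → G (v ∷ T)) lt′
  ...   | T , F<G = v ∷ T , F<G

  ∑ᵗ-distrib-+ : ∀ r (F G : Vec (Fin n) r → ℕ) → ∑ᵗ n r (λ T → F T + G T) ≡ ∑ᵗ n r F + ∑ᵗ n r G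
  ∑ᵗ-distrib-+ zero    F G = refl
  ∑ᵗ-distrib-+ (suc r) F G =
    trans (sum-cong-≗ (λ v → ∑ᵗ-distrib-+ r (λ T → F (v ∷ T)) (λ T → G (v ∷ T))))
          (∑-distrib-+ (λ v → ∑ᵗ n r (λ T → F (v ∷ T))) (λ v → ∑ᵗ n r (λ T → G (v ∷ T))))

  ∑ᵗ-const : ∀ r c → ∑ᵗ n r (λ _ → c) ≡ n ^ r * c
  ∑ᵗ-const zero    c = sym (+-identityʳ c)
  ∑ᵗ-const (suc r) c = begin
    ∑[ v < n ] ∑ᵗ n r (λ _ → c)  ≡⟨ sum-cong-≗ {n} (λ v → ∑ᵗ-const r c) ⟩
    ∑[ v < n ] (n ^ r * c)       ≡⟨ ∑-const n (n ^ r * c) ⟩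
    n * (n ^ r * c)              ≡⟨ *-assoc n (n ^ r) c ⟨
    n ^ suc r * c                ∎
    where open ≡-Reasoning

  *-distribˡ-∑ᵗ : ∀ r c (F : Vec (Fin n) r → ℕ) → c * ∑ᵗ n r F ≡ ∑ᵗ n r (λ T → c * F T)
  *-distribˡ-∑ᵗ zero    c F = refl
  *-distribˡ-∑ᵗ (suc r) c F =
    trans (*-distribˡ-sum c (λ v → ∑ᵗ n r (λ T → F (v ∷ T))))
          (sum-cong-≗ (λ v → *-distribˡ-∑ᵗ r c (λ T → F (v ∷ T))))

  ∑ᵗ-comm-∑ : ∀ r {m} (F : Vec (Fin n) r → Fin m → ℕ) →
              ∑ᵗ n r (λ T → ∑[ j < m ] F T j) ≡ ∑[ j < m ] ∑ᵗ n r (λ T → F T j)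
  ∑ᵗ-comm-∑ zero    F = refl
  ∑ᵗ-comm-∑ (suc r) F =
    trans (sum-cong-≗ (λ v → ∑ᵗ-comm-∑ r (λ T → F (v ∷ T))))
          (∑-comm (λ v j → ∑ᵗ n r (λ T → F (v ∷ T) j)))

  ∑ᵗ-comm : ∀ r s (F : Vec (Fin n) r → Vec (Fin n) s → ℕ) →
            ∑ᵗ n r (λ T → ∑ᵗ n s (F T)) ≡ ∑ᵗ n s (λ S → ∑ᵗ n r (λ T → F T S))
  ∑ᵗ-comm r zero    F = refl
  ∑ᵗ-comm r (suc s) F =
    trans (∑ᵗ-comm-∑ r (λ T v → ∑ᵗ n s (λ S → F T (v ∷ S))))
          (sum-cong-≗ (λ v → ∑ᵗ-comm r s (λ T S → F T (v ∷ S))))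

  ∑ᵗ-all : ∀ r (X : Fin n → Bool) → ∑ᵗ n r (λ T → ind (all X T)) ≡ count X ^ r
  ∑ᵗ-all zero    X = refl
  ∑ᵗ-all (suc r) X = begin
    ∑[ v < n ] ∑ᵗ n r (λ T → ind (X v ∧ all X T))      ≡⟨ sum-cong-≗ inner ⟩
    ∑[ v < n ] (count X ^ r * ind (X v))               ≡⟨ *-distribˡ-sum (count X ^ r) (λ v → ind (X v)) ⟨
    count X ^ r * count X                              ≡⟨ *-comm (count X ^ r) _ ⟩
    count X ^ suc r                                    ∎
    where
    open ≡-Reasoning
    inner : ∀ v → ∑ᵗ n r (λ T → ind (X v ∧ all X T)) ≡ count X ^ r * ind (X v)
    inner v = begin
      ∑ᵗ n r (λ T → ind (X v ∧ all X T))       ≡⟨ ∑ᵗ-cong r (λ T → ind-∧ (X v) (all X T)) ⟩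
      ∑ᵗ n r (λ T → ind (X v) * ind (all X T)) ≡⟨ *-distribˡ-∑ᵗ r (ind (X v)) _ ⟨
      ind (X v) * ∑ᵗ n r (λ T → ind (all X T)) ≡⟨ cong (ind (X v) *_) (∑ᵗ-all r X) ⟩
      ind (X v) * count X ^ r                  ≡⟨ *-comm (ind (X v)) _ ⟩
      count X ^ r * ind (X v)                  ∎

module Deletion {n r h : ℕ} (isBad : Vec (Fin n) (suc r) → Bool) where

  bad : (Fin n → Bool) → ℕ
  bad X = ∑ᵗ n (suc r) (λ S → ind (all X S ∧ isBad S))

  Clean : (Fin n → Bool) → Set
  Clean Y = ∀ S → all Y S ≡ true → isBad S ≡ false

  bad≡0⇒clean : ∀ X → bad X ≡ 0 → Clean X
  bad≡0⇒clean X bad≡0 S S⊆X with isBad S in S-bad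
  ... | false = refl
  ... | true  = contradiction 1≤0 λ ()
    where
    1≤0 : 1 ≤ 0
    1≤0 = subst₂ (λ a b → ind (a ∧ b) ≤ 0) S⊆X S-bad
              (subst (ind (all X S ∧ isBad S) ≤_) bad≡0 (f≤∑ᵗ (suc r) (λ S → ind (all X S ∧ isBad S)) S))

  bad>0⇒∃ : ∀ X → 0 < bad X → ∃[ S ] all X S ≡ true × isBad S ≡ true
  bad>0⇒∃ X bad>0 with ∑ᵗ<∑ᵗ⇒∃< (suc r) (λ _ → 0) (λ S → ind (all X S ∧ isBad S))
                          (subst (_< bad X) (sym (trans (∑ᵗ-const {n} (suc r) 0) (*-zeroʳ (n ^ suc r)))) bad>0)
  ... | S , 0<ind with ind<ind 0<ind
  ...   | _ , S∈X∧bad = S , ∧-conicalˡ _ _ S∈X∧bad , ∧-conicalʳ _ _ S∈X∧bad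

  bad-∖⁅⁆ : ∀ X v S → all X (v ∷ S) ≡ true → isBad (v ∷ S) ≡ true → bad (X ∖⁅ v ⁆) < bad X
  bad-∖⁅⁆ X v S vS⊆X vS-bad = ∑ᵗ-mono-< (suc r) shrinks (v ∷ S) strictly
    where
    X′⊆X : ∀ w → (X ∖⁅ v ⁆) w ≡ true → X w ≡ true
    X′⊆X w w∈X′ = ∧-conicalˡ _ _ w∈X′
    shrinks : ∀ S → ind (all (X ∖⁅ v ⁆) S ∧ isBad S) ≤ ind (all X S ∧ isBad S)
    shrinks S = ind-mono λ e → cong₂ _∧_ (all-mono X′⊆X S (∧-conicalˡ _ _ e)) (∧-conicalʳ _ _ e)
    strictly : ind (all (X ∖⁅ v ⁆) (v ∷ S) ∧ isBad (v ∷ S)) < ind (all X (v ∷ S) ∧ isBad (v ∷ S))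
    strictly rewrite ∉-∖⁅⁆ X v | vS⊆X | vS-bad = ≤-refl

  -- Deleting the first vertex of some bad tuple lowers `bad` by at least one and `count` by exactly one.
  deletion : ∀ X → bad X + h ≤ count X → ∃[ Y ] h ≤ count Y × Clean Y
  deletion X = <-rec Goal step (bad X) X refl
    where
    Goal : ℕ → Set
    Goal k = ∀ X → bad X ≡ k → bad X + h ≤ count X → ∃[ Y ] h ≤ count Y × Clean Y
    step : ∀ k → (∀ {j} → j < k → Goal j) → Goal k
    step _ rec X refl room with 0 <? bad X
    ... | no  bad≯0 = X , ≤-trans (m≤n+m h (bad X)) room , bad≡0⇒clean X (n≤0⇒n≡0 (≮⇒≥ bad≯0))
    ... | yes bad>0 with bad>0⇒∃ X bad>0
    ...   | v ∷ S , vS⊆X , vS-bad = rec fewer X′ refl room′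
      where
      X′ : Fin n → Bool
      X′ = X ∖⁅ v ⁆
      fewer : bad X′ < bad X
      fewer = bad-∖⁅⁆ X v S vS⊆X vS-bad
      room′ : bad X′ + h ≤ count X′
      room′ = ≤-pred (begin
        suc (bad X′ + h)  ≤⟨ +-monoˡ-≤ h fewer ⟩
        bad X + h         ≤⟨ room ⟩
        count X           ≡⟨ count-∖ X v (∧-conicalˡ _ _ vS⊆X) ⟨
        count X′ + 1      ≡⟨ +-comm (count X′) 1 ⟩
        suc (count X′)    ∎)
        where open ≤-Reasoning

record Representatives {n a} (Z : Fin a → Fin n → Bool) (E : Fin n → Bool) : Set where
  field
    pick       : Fin a → Fin n
    injective  : Injective _≡_ _≡_ pick
    pick∈Z     : ∀ x → Z x (pick x) ≡ true
    pick∉E     : ∀ x → E (pick x) ≡ false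
    used       : Fin n → Bool
    pick∈used  : ∀ x → used (pick x) ≡ true
    E⊆used     : ∀ w → E w ≡ true → used w ≡ true
    count-used : count used ≤ count E + a

greedy-representatives : ∀ {n} a (Z : Fin a → Fin n → Bool) (E : Fin n → Bool) →
  (∀ x → count E + a < count (Z x)) → Representatives Z E
greedy-representatives zero Z E _ = record
  { pick = λ (); injective = λ { {()} }; pick∈Z = λ (); pick∉E = λ ()
  ; used = E; pick∈used = λ (); E⊆used = λ _ w∈E → w∈E; count-used = m≤m+n _ 0 }
greedy-representatives {n} (suc a) Z E large with count<count⇒∃ E (Z zero) (≤-<-trans (m≤m+n _ (suc a)) (large zero))
... | v , v∉E , v∈Z₀ = record
  { pick = pick′; injective = injective′; pick∈Z = pick∈Z′; pick∉E = pick∉E′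
  ; used = used; pick∈used = pick∈used′; E⊆used = λ w w∈E → E⊆used w (cong (_∨ _) w∈E)
  ; count-used = ≤-trans count-used count-E∪v+a }
  where
  count-E∪v+a : count (E ∪⁅ v ⁆) + a ≤ count E + suc a
  count-E∪v+a = ≤-trans (+-monoˡ-≤ a (count-∪ E v)) (≤-reflexive (+-assoc (count E) 1 a))
  rest : Representatives (λ x → Z (suc x)) (E ∪⁅ v ⁆)
  rest = greedy-representatives a _ _ (λ x → ≤-<-trans count-E∪v+a (large (suc x)))
  open Representatives rest
  pick′ : Fin (suc a) → Fin n
  pick′ zero    = v
  pick′ (suc x) = pick x
  pick≢v : ∀ x → pick x ≢ v
  pick≢v x = proj₂ (∉-∪⁅⁆⁻¹ {X = E} (pick∉E x))
  injective′ : Injective _≡_ _≡_ pick′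
  injective′ {zero}  {zero}  _ = refl
  injective′ {zero}  {suc y} e = contradiction (sym e) (pick≢v y)
  injective′ {suc x} {zero}  e = contradiction e (pick≢v x)
  injective′ {suc x} {suc y} e = cong suc (injective e)
  pick∈Z′ : ∀ x → Z x (pick′ x) ≡ true
  pick∈Z′ zero    = v∈Z₀
  pick∈Z′ (suc x) = pick∈Z x
  pick∉E′ : ∀ x → E (pick′ x) ≡ false
  pick∉E′ zero    = v∉E
  pick∉E′ (suc x) = proj₁ (∉-∪⁅⁆⁻¹ {X = E} (pick∉E x))
  pick∈used′ : ∀ x → used (pick′ x) ≡ true
  pick∈used′ zero    = E⊆used v (∈-∪⁅⁆ E v)
  pick∈used′ (suc x) = pick∈used x

-- An r-tuple whose entries are the g y with P y, padded with copies of y₀.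
record PaddedImage {n b} r (P : Fin b → Bool) (g : Fin b → Fin n) (y₀ : Fin n) : Set where
  field
    tuple  : Vec (Fin n) r
    ⊇image : ∀ Q → all Q tuple ≡ true → ∀ y → P y ≡ true → Q (g y) ≡ true
    ⊆image : ∀ Q → Q y₀ ≡ true → (∀ y → Q (g y) ≡ true) → all Q tuple ≡ true

pad-image : ∀ {n b} r (P : Fin b → Bool) (g : Fin b → Fin n) (y₀ : Fin n) → count P ≤ r → PaddedImage r P g y₀
pad-image {b = zero} r P g y₀ _ = record
  { tuple = replicate r y₀; ⊇image = λ Q _ (); ⊆image = λ Q Qy₀ _ → all-replicate r {Q} Qy₀ }
pad-image {b = suc b} r P g y₀ count≤r with P zero in P₀
pad-image {b = suc b} zero    P g y₀ () | true
pad-image {b = suc b} (suc r) P g y₀ count≤r | true = record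
  { tuple = g zero ∷ tuple; ⊇image = ⊇image′; ⊆image = λ Q Qy₀ Qg → ⊆image′ Q Qy₀ Qg }
  where
  open PaddedImage (pad-image r (λ y → P (suc y)) (λ y → g (suc y)) y₀ (≤-pred count≤r))
  ⊇image′ : ∀ Q → all Q (g zero ∷ tuple) ≡ true → ∀ y → P y ≡ true → Q (g y) ≡ true
  ⊇image′ Q Q-all zero    _  = ∧-conicalˡ _ _ Q-all
  ⊇image′ Q Q-all (suc y) Py = ⊇image Q (∧-conicalʳ _ _ Q-all) y Py
  ⊆image′ : ∀ Q → Q y₀ ≡ true → (∀ y → Q (g y) ≡ true) → all Q (g zero ∷ tuple) ≡ true
  ⊆image′ Q Qy₀ Qg rewrite Qg zero = ⊆image Q Qy₀ (λ y → Qg (suc y))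
pad-image {b = suc b} r P g y₀ count≤r | false = record
  { tuple = tuple; ⊇image = ⊇image′; ⊆image = λ Q Qy₀ Qg → ⊆image Q Qy₀ (λ y → Qg (suc y)) }
  where
  open PaddedImage (pad-image r (λ y → P (suc y)) (λ y → g (suc y)) y₀ count≤r)
  ⊇image′ : ∀ Q → all Q tuple ≡ true → ∀ y → P y ≡ true → Q (g y) ≡ true
  ⊇image′ Q Q-all zero    P₀′ with () ← trans (sym P₀) P₀′
  ⊇image′ Q Q-all (suc y) Py  = ⊇image Q Q-all y Py

n^[2r+1]≡n^r*n^[r+1] : ∀ n r → n ^ (2 * suc r ∸ 1) ≡ n ^ r * n ^ suc r
n^[2r+1]≡n^r*n^[r+1] n r = trans (cong (n ^_) (exponent r)) (^-distribˡ-+-* n r (suc r))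
  where
  exponent : ∀ r → 2 * suc r ∸ 1 ≡ r + suc r
  exponent r = cong (r +_) (cong suc (+-identityʳ r))

m^[r+1]+m≤[2m]^[r+1] : ∀ m .{{_ : NonZero m}} r → m ^ suc r + m ≤ (2 * m) ^ suc r
m^[r+1]+m≤[2m]^[r+1] m r = begin
  m * m ^ r + m          ≤⟨ +-monoʳ-≤ (m * m ^ r) (subst (_≤ m * m ^ r) (*-identityʳ m) (*-monoʳ-≤ m (m^n>0 m r))) ⟩
  m * m ^ r + m * m ^ r  ≡⟨ double (m * m ^ r) ⟩
  2 * (m * m ^ r)        ≡⟨ *-assoc 2 m _ ⟨
  2 * m * m ^ r          ≤⟨ *-monoʳ-≤ (2 * m) (^-monoˡ-≤ r (m≤n*m m 2)) ⟩
  2 * m * (2 * m) ^ r    ∎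
  where
  open ≤-Reasoning
  double : ∀ x → x + x ≡ 2 * x
  double = solve-∀

module DependentRandomChoice {n : ℕ} (G : Digraph n) {r a b : ℕ} (H : BipDigraph a b)
                             (H-degree : ∀ x → count (H x) ≤ suc r) where

  h : ℕ
  h = suc (a + b)

  inDegree : Fin n → ℕ
  inDegree v = ∑[ u < n ] ind (G u v)

  N⁺ N⁻ : Vec (Fin n) (suc r) → Fin n → Bool
  N⁺ T u = all (λ t → G t u) T
  N⁻ S x = all (G x) S

  isBad : Vec (Fin n) (suc r) → Bool
  isBad S = count (N⁻ S) <ᵇ h

  open Deletion {n} {r} {h} isBad

  ∑-count-N⁺ : ∑ᵗ n (suc r) (λ T → count (N⁺ T)) ≡ ∑[ v < n ] (inDegree v ^ suc r)
  ∑-count-N⁺ = trans (∑ᵗ-comm-∑ (suc r) (λ T v → ind (N⁺ T v)))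
                     (sum-cong-≗ (λ v → ∑ᵗ-all (suc r) (λ t → G t v)))

  ∑-N⁺⊇bad≤h^[r+1] : ∀ S → ∑ᵗ n (suc r) (λ T → ind (all (N⁺ T) S ∧ isBad S)) ≤ h ^ suc r
  ∑-N⁺⊇bad≤h^[r+1] S with isBad S in S-bad
  ... | false = ≤-trans (≤-reflexive none) z≤n
    where
    none : ∑ᵗ n (suc r) (λ T → ind (all (N⁺ T) S ∧ false)) ≡ 0
    none = trans (∑ᵗ-cong {n} (suc r) (λ T → cong ind (∧-zeroʳ (all (N⁺ T) S))))
                 (trans (∑ᵗ-const {n} (suc r) 0) (*-zeroʳ (n ^ suc r)))
  ... | true  = begin
    ∑ᵗ n (suc r) (λ T → ind (all (N⁺ T) S ∧ true))
      ≡⟨ ∑ᵗ-cong {n} (suc r) (λ T → cong ind (∧-identityʳ (all (N⁺ T) S))) ⟩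
    ∑ᵗ n (suc r) (λ T → ind (all (N⁺ T) S))
      ≡⟨ ∑ᵗ-cong {n} (suc r) (λ T → cong ind (all-comm G T S)) ⟩
    ∑ᵗ n (suc r) (λ T → ind (all (N⁻ S) T))
      ≡⟨ ∑ᵗ-all (suc r) (N⁻ S) ⟩
    count (N⁻ S) ^ suc r
      ≤⟨ ^-monoˡ-≤ (suc r) (<⇒≤ (<ᵇ⇒< (count (N⁻ S)) h (subst T (sym S-bad) tt))) ⟩
    h ^ suc r ∎
    where open ≤-Reasoning

  ∑-bad-N⁺ : ∑ᵗ n (suc r) (λ T → bad (N⁺ T)) ≤ n ^ suc r * h ^ suc r
  ∑-bad-N⁺ = begin
    ∑ᵗ n (suc r) (λ T → bad (N⁺ T))
      ≡⟨ ∑ᵗ-comm {n} (suc r) (suc r) (λ T S → ind (all (N⁺ T) S ∧ isBad S)) ⟩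
    ∑ᵗ n (suc r) (λ S → ∑ᵗ n (suc r) (λ T → ind (all (N⁺ T) S ∧ isBad S)))
      ≤⟨ ∑ᵗ-mono-≤ {n} (suc r) ∑-N⁺⊇bad≤h^[r+1] ⟩
    ∑ᵗ n (suc r) (λ _ → h ^ suc r)
      ≡⟨ ∑ᵗ-const {n} (suc r) _ ⟩
    n ^ suc r * h ^ suc r ∎
    where open ≤-Reasoning

  arcCount : ℕ
  arcCount = ∑[ u < n ] ∑[ v < n ] ind (G u v)

  c : ℕ
  c = 2 * h

  many-arcs⇒∑-count-N⁺ : c ^ suc r * n ^ (2 * suc r ∸ 1) < arcCount ^ suc r →
                          n ^ suc r * c ^ suc r < ∑ᵗ n (suc r) (λ T → count (N⁺ T))
  many-arcs⇒∑-count-N⁺ many = *-cancelˡ-< (n ^ r) _ _ (begin-strict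
    n ^ r * (n ^ suc r * c ^ suc r)           ≡⟨ reorder (n ^ r) (n ^ suc r) (c ^ suc r) ⟩
    c ^ suc r * (n ^ r * n ^ suc r)           ≡⟨ cong (c ^ suc r *_) (n^[2r+1]≡n^r*n^[r+1] n r) ⟨
    c ^ suc r * n ^ (2 * suc r ∸ 1)           <⟨ many ⟩
    arcCount ^ suc r                          ≡⟨ cong (_^ suc r) (∑-comm (λ u v → ind (G u v))) ⟩
    (∑[ v < n ] inDegree v) ^ suc r           ≤⟨ power-mean n r inDegree ⟩
    n ^ r * ∑[ v < n ] (inDegree v ^ suc r)   ≡⟨ cong (n ^ r *_) ∑-count-N⁺ ⟨
    n ^ r * ∑ᵗ n (suc r) (λ T → count (N⁺ T)) ∎)
    where
    open ≤-Reasoning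
    reorder : ∀ x y z → x * (y * z) ≡ z * (x * y)
    reorder = solve-∀

  many-arcs⇒rich-tuple : c ^ suc r * n ^ (2 * suc r ∸ 1) < arcCount ^ suc r →
                         ∃[ T ] bad (N⁺ T) + h < count (N⁺ T)
  many-arcs⇒rich-tuple many =
    ∑ᵗ<∑ᵗ⇒∃< (suc r) (λ T → bad (N⁺ T) + h) (λ T → count (N⁺ T)) (begin-strict
      ∑ᵗ n (suc r) (λ T → bad (N⁺ T) + h)
        ≡⟨ ∑ᵗ-distrib-+ (suc r) (λ T → bad (N⁺ T)) (λ _ → h) ⟩
      ∑ᵗ n (suc r) (λ T → bad (N⁺ T)) + ∑ᵗ n (suc r) (λ _ → h)
        ≤⟨ +-mono-≤ ∑-bad-N⁺ (≤-reflexive (∑ᵗ-const {n} (suc r) h)) ⟩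
      n ^ suc r * h ^ suc r + n ^ suc r * h
        ≡⟨ *-distribˡ-+ (n ^ suc r) (h ^ suc r) h ⟨
      n ^ suc r * (h ^ suc r + h)
        ≤⟨ *-monoʳ-≤ (n ^ suc r) (m^[r+1]+m≤[2m]^[r+1] h r) ⟩
      n ^ suc r * c ^ suc r
        <⟨ many-arcs⇒∑-count-N⁺ many ⟩
      ∑ᵗ n (suc r) (λ T → count (N⁺ T)) ∎)
    where open ≤-Reasoning

  clean⇒contains : ∀ Y → h ≤ count Y → Clean Y → Contains G H
  clean⇒contains Y h≤|Y| Y-clean with count<count⇒∃ (λ _ → false) Y ∅<Y
    where
    ∅<Y : count {n} (λ _ → false) < count Y
    ∅<Y = subst (_< count Y) (sym (count-∅ n)) (≤-trans (s≤s z≤n) h≤|Y|)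
  ... | y₀ , _ , y₀∈Y = A.pick , B.pick , A.injective , B.injective , disjoint , arcs-preserved
    where
    B-fits : count {n} (λ _ → false) + b < count Y
    B-fits = <-≤-trans (s≤s (≤-trans (≤-reflexive (cong (_+ b) (count-∅ n))) (m≤n+m b a))) h≤|Y|
    module B = Representatives (greedy-representatives b (λ _ → Y) (λ _ → false) λ _ → B-fits)
    module Pad (x : Fin a) = PaddedImage (pad-image (suc r) (H x) B.pick y₀ (H-degree x))
    h≤|N⁻| : ∀ x → h ≤ count (N⁻ (Pad.tuple x))
    h≤|N⁻| x = ≮⇒≥ λ lt → subst T (Y-clean (Pad.tuple x) (Pad.⊆image x Y y₀∈Y B.pick∈Z)) (<⇒<ᵇ lt)
    A-fits : count B.used + a < h
    A-fits = s≤s (begin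
      count B.used + a                  ≤⟨ +-monoˡ-≤ a B.count-used ⟩
      count {n} (λ _ → false) + b + a   ≡⟨ cong (λ k → k + b + a) (count-∅ n) ⟩
      b + a                             ≡⟨ +-comm b a ⟩
      a + b                             ∎)
      where open ≤-Reasoning
    module A = Representatives
      (greedy-representatives a (λ x → N⁻ (Pad.tuple x)) B.used λ x → <-≤-trans A-fits (h≤|N⁻| x))
    disjoint : ∀ x y → A.pick x ≢ B.pick y
    disjoint x y eq with () ← trans (sym (A.pick∉E x)) (trans (cong B.used eq) (B.pick∈used y))
    arcs-preserved : ∀ x y → H x y ≡ true → G (A.pick x) (B.pick y) ≡ true
    arcs-preserved x = Pad.⊇image x (G (A.pick x)) (A.pick∈Z x)

  many-arcs⇒contains : c ^ suc r * n ^ (2 * suc r ∸ 1) < arcCount ^ suc r → Contains G H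
  many-arcs⇒contains many with many-arcs⇒rich-tuple many
  ... | T , room with deletion (N⁺ T) (<⇒≤ room)
  ...   | Y , h≤|Y| , Y-clean = clean⇒contains Y h≤|Y| Y-clean

theorem1p4 : (r : ℕ) → 1 ≤ r → (a b : ℕ) → (H : BipDigraph a b)
    → (∀ (x : Fin a) → outdegB H x ≤ r)
    → ∃[ c ] (∀ (n : ℕ) (G : Digraph n) → Oriented G → ¬ Contains G H
        → arcs G ^ r ≤ (c ^ r) * (n ^ (2 * r ∸ 1)))
theorem1p4 (suc r) _ a b H outdeg≤r = 2 * suc (a + b) , bound
  where
  bound : ∀ n (G : Digraph n) → Oriented G → ¬ Contains G H →
          arcs G ^ suc r ≤ (2 * suc (a + b)) ^ suc r * n ^ (2 * suc r ∸ 1)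
  bound n G _ G∌H with arcs G ^ suc r ≤? (2 * suc (a + b)) ^ suc r * n ^ (2 * suc r ∸ 1)
  ... | yes few  = few
  ... | no  too-many = contradiction (many-arcs⇒contains many) G∌H
    where
    open DependentRandomChoice G H (λ x → subst (_≤ suc r) (ΣFin≡sum b _) (outdeg≤r x))
    arcs≡arcCount : arcs G ≡ arcCount
    arcs≡arcCount = trans (ΣFin≡sum n _) (sum-cong-≗ {n} (λ u → ΣFin≡sum n (λ v → ind (G u v))))
    many : c ^ suc r * n ^ (2 * suc r ∸ 1) < arcCount ^ suc r
    many = subst (λ e → c ^ suc r * n ^ (2 * suc r ∸ 1) < e ^ suc r) arcs≡arcCount (≰⇒> too-many)
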